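{- Let $k,\ell \geq 0$ be integers. If a rooted graph $(G,i)$ allows the nullity pair $(k+1,\ell+1)$, then it allows the nullity pair $(k,\ell)$.
   Context: All graphs are finite and simple. For a graph $G$ on $n$ vertices labeled $1,\dots,n$, $\mathcal{S}(G)$ is the set of $n\times n$ real symmetric matrices whose off-diagonal $(j,k)$-entry is nonzero iff $\{j,k\}\in E(G)$ (diagonal arbitrary). $A(i)$ is $A$ with row and column $i$ deleted. The $i$-nullity pair of $A$ is $(\operatorname{null}(A),\operatorname{null}(A(i)))$. A rooted graph $(G,i)$ is a graph with a designated root vertex $i$; it allows the nullity pair $(k,\ell)$ if some $A\in\mathcal{S}(G)$ has $i$-nullity pair $(k,\ell)$. -}

module Defs where

open import Level using (0ℓ)
open import Data.Nat using (ℕ; zero; suc)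
open import Data.Fin using (Fin; zero; suc; punchIn)
open import Data.Bool using (Bool; true)
open import Data.Product using (Σ; ∃; _×_; _,_)
open import Relation.Nullary using (¬_)
open import Relation.Binary.PropositionalEquality using (_≡_)
open import Relation.Binary.Structures using (IsTotalOrder)
open import Algebra.Bundles using (CommutativeRing)

-- The real numbers, axiomatised as a (Dedekind-)complete ordered field.
-- Any two such fields are isomorphic, so quantifying over all of them
-- is the same as speaking about ℝ.

record RealField : Set₁ where
  field
    commutativeRing : CommutativeRing 0ℓ 0ℓ
  open CommutativeRing commutativeRing public
  field
    0≉1      : ¬ (0# ≈ 1#)
    inverse  : ∀ x → ¬ (x ≈ 0#) → ∃ λ y → x * y ≈ 1#
    _≤_      : Carrier → Carrier → Set
    isTotalOrder : IsTotalOrder _≈_ _≤_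
    +-mono-≤ : ∀ {x y} z → x ≤ y → (x + z) ≤ (y + z)
    *-nonneg : ∀ {x y} → 0# ≤ x → 0# ≤ y → 0# ≤ (x * y)
    complete : (P : Carrier → Set) → (∃ λ x → P x) →
               (∃ λ b → ∀ x → P x → x ≤ b) →
               ∃ λ s → (∀ x → P x → x ≤ s) ×
                       (∀ b → (∀ x → P x → x ≤ b) → s ≤ b)

record Graph (n : ℕ) : Set where
  field
    adj    : Fin n → Fin n → Bool
    sym    : ∀ j k → adj j k ≡ adj k j
    irrefl : ∀ j → ¬ (adj j j ≡ true)

Edge : ∀ {n} → Graph n → Fin n → Fin n → Set
Edge G j k = Graph.adj G j k ≡ true

module _ (R : RealField) where
  open RealField R using (Carrier; _≈_; _+_; _*_; 0#)

  Matrix : ℕ → Set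
  Matrix n = Fin n → Fin n → Carrier

  Vector : ℕ → Set
  Vector n = Fin n → Carrier

  ∑ : ∀ {n} → (Fin n → Carrier) → Carrier
  ∑ {zero}  f = 0#
  ∑ {suc n} f = f zero + ∑ (λ j → f (suc j))

  InKernel : ∀ {n} → Matrix n → Vector n → Set
  InKernel A v = ∀ r → ∑ (λ c → A r c * v c) ≈ 0#

  LinearlyIndependent : ∀ {n k} → (Fin k → Vector n) → Set
  LinearlyIndependent {n} {k} vs =
    (c : Fin k → Carrier) →
    (∀ r → ∑ (λ j → c j * vs j r) ≈ 0#) → ∀ j → c j ≈ 0#

  IndepKernelFamily : ∀ {n} → Matrix n → ℕ → Set
  IndepKernelFamily {n} A k =
    Σ (Fin k → Vector n) λ vs → (∀ j → InKernel A (vs j)) × LinearlyIndependent vs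

  Nullity : ∀ {n} → Matrix n → ℕ → Set
  Nullity A k = IndepKernelFamily A k × ¬ IndepKernelFamily A (suc k)

  InS : ∀ {n} → Graph n → Matrix n → Set
  InS G A = (∀ j k → A j k ≈ A k j) ×
            (∀ j k → ¬ (j ≡ k) → ((¬ (A j k ≈ 0#) → Edge G j k) × (Edge G j k → ¬ (A j k ≈ 0#))))

  deleteRC : ∀ {m} → Matrix (suc m) → Fin (suc m) → Matrix m
  deleteRC A i j k = A (punchIn i j) (punchIn i k)

  Allows : ∀ {m} → Graph (suc m) → Fin (suc m) → ℕ → ℕ → Set
  Allows G i k ℓ = Σ (Matrix _) λ A → InS G A × Nullity A k × Nullity (deleteRC A i) ℓ

{-# OPTIONS --safe #-}
-- Change one diagonal entry: B = A + E_jj for a vertex j ≠ i. Off-diagonal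
-- entries are untouched, so B ∈ 𝒮(G), and B(i) = A(i) + E_jj. For a symmetric
-- matrix M of nullity p + 1 with a null vector v, v_j ≠ 0, the null space of
-- M + E_jj consists of the null vectors z of M vanishing at j (since
-- 0 = vᵀ(M + E_jj)z = v_j z_j), so null(M + E_jj) = p. Hence both nullities
-- drop by one as soon as some null vector of A and some null vector of A(i)
-- are both nonzero at j. Such a j exists: otherwise either every null vector
-- of A vanishes at i, and restricting one of them enlarges a basis of ker A(i),
-- or one does not, and then (by symmetry) every null vector of A(i) extends by
-- 0 to a null vector of A, enlarging a basis of ker A.
module Submission where

open import Defs
open import Data.Nat using (ℕ; zero; suc)
open import Data.Fin using (Fin; zero; suc; punchIn; punchOut; _≟_)
open import Data.Fin.Properties using (punchIn-injective; punchInᵢ≢i; punchIn-punchOut)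
open import Data.Vec.Functional using (_∷_; insertAt)
open import Data.Vec.Functional.Properties using (insertAt-punchIn; insertAt-lookup)
open import Data.Product using (∃; ∃₂; _×_; _,_; proj₁; proj₂)
open import Data.Sum using (inj₁; inj₂)
open import Data.Empty using (⊥)
open import Function using (_∘_; flip)
open import Relation.Nullary using (¬_; yes; no; contradiction)
open import Relation.Binary.PropositionalEquality as ≡ using (_≡_)
open import Relation.Binary.Structures using (IsTotalOrder)
import Algebra.Properties.CommutativeSemigroup as CommutativeSemigroupProperties
import Algebra.Properties.Ring as RingProperties
import Algebra.Properties.Semiring.Sum as SemiringSum
import Relation.Binary.Reasoning.Setoid as SetoidReasoning

∀-punchIn : ∀ {n} {P : Fin (suc n) → Set} (i : Fin (suc n)) →
            P i → (∀ j → P (punchIn i j)) → ∀ j → P j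
∀-punchIn {P = P} i Pi P-punchIn j with i ≟ j
... | yes ≡.refl = Pi
... | no i≢j = ≡.subst P (punchIn-punchOut i≢j) (P-punchIn (punchOut i≢j))

module NullityPairs (R : RealField) where

  open RealField R hiding (zero)
  open SetoidReasoning setoid
  open CommutativeSemigroupProperties *-commutativeSemigroup using (x∙yz≈y∙xz; x∙yz≈z∙yx)
  open RingProperties ring using (-‿involutive; -0#≈0#; -‿distribˡ-*)
  open SemiringSum semiring using (sum)
  private
    module Sum = SemiringSum semiring
    module ≤ = IsTotalOrder isTotalOrder

  private
    variable
      n p : ℕ

  *-zero-cancelˡ : ∀ {x y} → ¬ x ≈ 0# → x * y ≈ 0# → y ≈ 0#
  *-zero-cancelˡ {x} {y} x≉0 xy≈0 =
    let (x⁻¹ , xx⁻¹≈1) = inverse x x≉0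
    in begin
      y              ≈⟨ *-identityˡ y ⟨
      1# * y         ≈⟨ *-congʳ (trans (sym xx⁻¹≈1) (*-comm x x⁻¹)) ⟩
      (x⁻¹ * x) * y  ≈⟨ *-assoc x⁻¹ x y ⟩
      x⁻¹ * (x * y)  ≈⟨ *-congˡ xy≈0 ⟩
      x⁻¹ * 0#       ≈⟨ zeroʳ x⁻¹ ⟩
      0#             ∎

  *-zero-cancelʳ : ∀ {x y} → ¬ x ≈ 0# → y * x ≈ 0# → y ≈ 0#
  *-zero-cancelʳ x≉0 yx≈0 = *-zero-cancelˡ x≉0 (trans (*-comm _ _) yx≈0)

  ∑≈sum : (f : Vector R n) → ∑ R f ≈ sum f
  ∑≈sum {zero}  f = refl
  ∑≈sum {suc n} f = +-congˡ (∑≈sum (f ∘ suc))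

  ∑-cong : {f g : Vector R n} → (∀ j → f j ≈ g j) → ∑ R f ≈ ∑ R g
  ∑-cong {f = f} {g} f≈g = begin
    ∑ R f  ≈⟨ ∑≈sum f ⟩
    sum f  ≈⟨ Sum.sum-cong-≋ f≈g ⟩
    sum g  ≈⟨ ∑≈sum g ⟨
    ∑ R g  ∎

  ∑-zero : {f : Vector R n} → (∀ j → f j ≈ 0#) → ∑ R f ≈ 0#
  ∑-zero {n} f≈0 = trans (∑-cong f≈0) (trans (∑≈sum {n} (λ _ → 0#)) (Sum.sum-replicate-zero n))

  ∑-distrib-+ : (f g : Vector R n) → ∑ R (λ j → f j + g j) ≈ ∑ R f + ∑ R g
  ∑-distrib-+ f g = begin
    ∑ R (λ j → f j + g j)  ≈⟨ ∑≈sum (λ j → f j + g j) ⟩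
    sum (λ j → f j + g j)  ≈⟨ Sum.∑-distrib-+ f g ⟩
    sum f + sum g          ≈⟨ +-cong (∑≈sum f) (∑≈sum g) ⟨
    ∑ R f + ∑ R g          ∎

  *-distribˡ-∑ : ∀ x (f : Vector R n) → x * ∑ R f ≈ ∑ R (λ j → x * f j)
  *-distribˡ-∑ x f = begin
    x * ∑ R f              ≈⟨ *-congˡ (∑≈sum f) ⟩
    x * sum f              ≈⟨ Sum.*-distribˡ-sum x f ⟩
    sum (λ j → x * f j)    ≈⟨ ∑≈sum (λ j → x * f j) ⟨
    ∑ R (λ j → x * f j)    ∎

  *-distribʳ-∑ : ∀ x (f : Vector R n) → ∑ R f * x ≈ ∑ R (λ j → f j * x)
  *-distribʳ-∑ x f = begin
    ∑ R f * x              ≈⟨ *-congʳ (∑≈sum f) ⟩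
    sum f * x              ≈⟨ Sum.*-distribʳ-sum x f ⟩
    sum (λ j → f j * x)    ≈⟨ ∑≈sum (λ j → f j * x) ⟨
    ∑ R (λ j → f j * x)    ∎

  ∑-comm : ∀ {m} (f : Fin m → Fin n → Carrier) →
           ∑ R (λ a → ∑ R (f a)) ≈ ∑ R (λ b → ∑ R (λ a → f a b))
  ∑-comm f = begin
    ∑ R (λ a → ∑ R (f a))            ≈⟨ ∑≈sum₂ f ⟩
    sum (λ a → sum (f a))            ≈⟨ Sum.∑-comm f ⟩
    sum (λ b → sum (λ a → f a b))    ≈⟨ ∑≈sum₂ (flip f) ⟨
    ∑ R (λ b → ∑ R (λ a → f a b))    ∎
    where
    ∑≈sum₂ : ∀ {k l} (g : Fin k → Fin l → Carrier) →
             ∑ R (λ a → ∑ R (g a)) ≈ sum (λ a → sum (g a))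
    ∑≈sum₂ g = trans (∑-cong (λ a → ∑≈sum (g a))) (∑≈sum (λ a → sum (g a)))

  ∑-remove : (i : Fin (suc n)) (f : Vector R (suc n)) →
             ∑ R f ≈ f i + ∑ R (f ∘ punchIn i)
  ∑-remove i f = begin
    ∑ R f                       ≈⟨ ∑≈sum f ⟩
    sum f                       ≈⟨ Sum.sum-remove {i = i} f ⟩
    f i + sum (f ∘ punchIn i)   ≈⟨ +-congˡ (∑≈sum (f ∘ punchIn i)) ⟨
    f i + ∑ R (f ∘ punchIn i)   ∎

  -- Equality with 0# is undecidable, but the total order lets us pick an entry
  -- of maximal absolute value: it vanishes only if all entries do.

  ∣_∣ : Carrier → Carrier
  ∣ x ∣ with ≤.total 0# x
  ... | inj₁ _ = x
  ... | inj₂ _ = - x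

  ∣∣-nonneg : ∀ x → 0# ≤ ∣ x ∣
  ∣∣-nonneg x with ≤.total 0# x
  ... | inj₁ 0≤x = 0≤x
  ... | inj₂ x≤0 = ≤.trans (≤.reflexive (sym (-‿inverseʳ x)))
                     (≤.trans (+-mono-≤ (- x) x≤0) (≤.reflexive (+-identityˡ (- x))))

  ∣∣≈0⇒≈0 : ∀ x → ∣ x ∣ ≈ 0# → x ≈ 0#
  ∣∣≈0⇒≈0 x with ≤.total 0# x
  ... | inj₁ _ = λ x≈0 → x≈0
  ... | inj₂ _ = λ -x≈0 → trans (sym (-‿involutive x)) (trans (-‿cong -x≈0) -0#≈0#)

  ≈0⇒∣∣≈0 : ∀ x → x ≈ 0# → ∣ x ∣ ≈ 0#
  ≈0⇒∣∣≈0 x with ≤.total 0# x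
  ... | inj₁ _ = λ x≈0 → x≈0
  ... | inj₂ _ = λ x≈0 → trans (-‿cong x≈0) -0#≈0#

  argmax-∣∣ : (f : Vector R (suc n)) → ∃ λ t → ∀ s → ∣ f s ∣ ≤ ∣ f t ∣
  argmax-∣∣ {zero} f = zero , λ { zero → ≤.refl }
  argmax-∣∣ {suc n} f with argmax-∣∣ (f ∘ suc)
  ... | t , ≤t with ≤.total ∣ f zero ∣ ∣ f (suc t) ∣
  ...   | inj₁ f₀≤ = suc t , λ { zero → f₀≤ ; (suc s) → ≤t s }
  ...   | inj₂ ≤f₀ = zero , λ { zero → ≤.refl ; (suc s) → ≤.trans (≤t s) ≤f₀ }

  decisive-index : (f : Vector R (suc n)) → ∃ λ t → f t ≈ 0# → ∀ s → f s ≈ 0#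
  decisive-index f =
    let (t , ≤t) = argmax-∣∣ f
    in t , λ ft≈0 s → ∣∣≈0⇒≈0 (f s)
             (≤.antisym (≤.trans (≤t s) (≤.reflexive (≈0⇒∣∣≈0 (f t) ft≈0))) (∣∣-nonneg (f s)))

  decisive-index₂ : ∀ {k l} (f : Fin (suc k) → Fin (suc l) → Carrier) →
                    ∃₂ λ a b → f a b ≈ 0# → ∀ a b → f a b ≈ 0#
  decisive-index₂ {k} {l} f =
    let (a , decisive-a) = decisive-index (λ a → f a (best a))
    in a , best a , λ fab≈0 a′ → proj₂ (decisive-index (f a′)) (decisive-a fab≈0 a′)
    where
    best : Fin (suc k) → Fin (suc l)
    best a = proj₁ (decisive-index (f a))

  nonzero-index : (f : Vector R n) → ¬ (∀ s → f s ≈ 0#) → ∃ λ t → ¬ f t ≈ 0#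
  nonzero-index {zero} f f≉0 = contradiction (λ ()) f≉0
  nonzero-index {suc n} f f≉0 =
    let (t , decisive) = decisive-index f
    in t , λ ft≈0 → f≉0 (decisive ft≈0)

  nonzero-entry : ∀ {k l} (f : Fin n → Fin (suc k) → Fin (suc l) → Carrier) →
                  ¬ (∀ j a b → f j a b ≈ 0#) → ∃ λ j → ∃₂ λ a b → ¬ f j a b ≈ 0#
  nonzero-entry {n = n} {k} {l} f f≉0 =
    let (j , g≉0) = nonzero-index (λ j → f j (a j) (b j)) (λ g≈0 → f≉0 (λ j → decisive j (g≈0 j)))
    in j , a j , b j , g≉0
    where
    a : Fin n → Fin (suc k)
    a j = proj₁ (decisive-index₂ (f j))
    b : Fin n → Fin (suc l)
    b j = proj₁ (proj₂ (decisive-index₂ (f j)))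
    decisive : ∀ j → f j (a j) (b j) ≈ 0# → ∀ a′ b′ → f j a′ b′ ≈ 0#
    decisive j = proj₂ (proj₂ (decisive-index₂ (f j)))

  δ : Fin n → Fin n → Carrier
  δ j r with j ≟ r
  ... | yes _ = 1#
  ... | no _  = 0#

  δ-diag : ∀ (j : Fin n) → δ j j ≈ 1#
  δ-diag j with j ≟ j
  ... | yes _  = refl
  ... | no j≢j = contradiction ≡.refl j≢j

  δ-offdiag : ∀ {j r : Fin n} → ¬ j ≡ r → δ j r ≈ 0#
  δ-offdiag {j = j} {r} j≢r with j ≟ r
  ... | yes j≡r = contradiction j≡r j≢r
  ... | no _    = refl

  δ-punchIn : ∀ (i : Fin (suc n)) j r → δ (punchIn i j) (punchIn i r) ≈ δ j r
  δ-punchIn i j r with j ≟ r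
  ... | yes ≡.refl = δ-diag (punchIn i j)
  ... | no j≢r     = δ-offdiag (j≢r ∘ punchIn-injective i j r)

  ∑-δ : ∀ (j : Fin n) (f : Vector R n) → ∑ R (λ r → δ j r * f r) ≈ f j
  ∑-δ {suc n} j f = begin
    ∑ R (λ r → δ j r * f r)
      ≈⟨ ∑-remove j (λ r → δ j r * f r) ⟩
    δ j j * f j + ∑ R (λ r → δ j (punchIn j r) * f (punchIn j r))
      ≈⟨ +-cong (*-congʳ (δ-diag j))
                (∑-zero (λ r → trans (*-congʳ (δ-offdiag (punchInᵢ≢i j r ∘ ≡.sym))) (zeroˡ _))) ⟩
    1# * f j + 0#
      ≈⟨ trans (+-identityʳ _) (*-identityˡ _) ⟩
    f j ∎

  IsSymmetric : Matrix R n → Set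
  IsSymmetric M = ∀ r c → M r c ≈ M c r

  _*ᵥ_ : Matrix R n → Vector R n → Vector R n
  (M *ᵥ v) r = ∑ R (λ c → M r c * v c)

  ⟨_,_⟩ : Vector R n → Vector R n → Carrier
  ⟨ v , w ⟩ = ∑ R (λ r → v r * w r)

  InKernel-+* : ∀ {M : Matrix R n} {v w} → InKernel R M v → InKernel R M w →
                ∀ s → InKernel R M (λ c → v c + s * w c)
  InKernel-+* {M = M} {v} {w} v∈ker w∈ker s r = begin
    ∑ R (λ c → M r c * (v c + s * w c))
      ≈⟨ ∑-cong (λ c → trans (distribˡ (M r c) (v c) (s * w c))
                             (+-congˡ (x∙yz≈y∙xz (M r c) s (w c)))) ⟩
    ∑ R (λ c → M r c * v c + s * (M r c * w c))
      ≈⟨ ∑-distrib-+ (λ c → M r c * v c) _ ⟩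
    (M *ᵥ v) r + ∑ R (λ c → s * (M r c * w c))
      ≈⟨ +-cong (v∈ker r) (sym (*-distribˡ-∑ s (λ c → M r c * w c))) ⟩
    0# + s * (M *ᵥ w) r
      ≈⟨ trans (+-identityˡ _) (trans (*-congˡ (w∈ker r)) (zeroʳ s)) ⟩
    0# ∎

  kernel-⊥-image : ∀ {M : Matrix R n} → IsSymmetric M →
                   ∀ v → InKernel R M v → ∀ z → ⟨ v , M *ᵥ z ⟩ ≈ 0#
  kernel-⊥-image {M = M} M-sym v v∈ker z = begin
    ∑ R (λ r → v r * ∑ R (λ c → M r c * z c))
      ≈⟨ ∑-cong (λ r → *-distribˡ-∑ (v r) (λ c → M r c * z c)) ⟩
    ∑ R (λ r → ∑ R (λ c → v r * (M r c * z c)))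
      ≈⟨ ∑-comm (λ r c → v r * (M r c * z c)) ⟩
    ∑ R (λ c → ∑ R (λ r → v r * (M r c * z c)))
      ≈⟨ ∑-cong (λ c → ∑-cong (λ r →
           trans (*-congˡ (*-congʳ (M-sym r c))) (x∙yz≈z∙yx (v r) (M c r) (z c)))) ⟩
    ∑ R (λ c → ∑ R (λ r → z c * (M c r * v r)))
      ≈⟨ ∑-cong (λ c → *-distribˡ-∑ (z c) (λ r → M c r * v r)) ⟨
    ∑ R (λ c → z c * (M *ᵥ v) c)
      ≈⟨ ∑-zero (λ c → trans (*-congˡ (v∈ker c)) (zeroʳ _)) ⟩
    0# ∎

  InKernel-cong : ∀ {M M′ : Matrix R n} {v} → (∀ r c → M r c ≈ M′ r c) →
                  InKernel R M v → InKernel R M′ v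
  InKernel-cong M≈M′ v∈ker r = trans (∑-cong (λ c → *-congʳ (sym (M≈M′ r c)))) (v∈ker r)

  IndepKernelFamily-cong : ∀ {M M′ : Matrix R n} → (∀ r c → M r c ≈ M′ r c) →
                           IndepKernelFamily R M p → IndepKernelFamily R M′ p
  IndepKernelFamily-cong M≈M′ (vs , vs∈ker , vs-indep) =
    vs , (λ a → InKernel-cong M≈M′ (vs∈ker a)) , vs-indep

  Nullity-cong : ∀ {M M′ : Matrix R n} → (∀ r c → M r c ≈ M′ r c) →
                 Nullity R M p → Nullity R M′ p
  Nullity-cong M≈M′ (basis , maximal) =
    IndepKernelFamily-cong M≈M′ basis ,
    maximal ∘ IndepKernelFamily-cong (λ r c → sym (M≈M′ r c))

  restrict-kernel : ∀ (A : Matrix R (suc n)) i {v} → InKernel R A v → v i ≈ 0# →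
                    InKernel R (deleteRC R A i) (v ∘ punchIn i)
  restrict-kernel A i {v} v∈ker vi≈0 r = begin
    ∑ R (λ c → A (punchIn i r) (punchIn i c) * v (punchIn i c))
      ≈⟨ +-identityˡ _ ⟨
    0# + ∑ R (λ c → A (punchIn i r) (punchIn i c) * v (punchIn i c))
      ≈⟨ +-congʳ (trans (*-congˡ vi≈0) (zeroʳ _)) ⟨
    A (punchIn i r) i * v i + ∑ R (λ c → A (punchIn i r) (punchIn i c) * v (punchIn i c))
      ≈⟨ ∑-remove i (λ c → A (punchIn i r) c * v c) ⟨
    (A *ᵥ v) (punchIn i r)
      ≈⟨ v∈ker (punchIn i r) ⟩
    0# ∎

  *ᵥ-insertAt-0 : ∀ (A : Matrix R (suc n)) i w r →
                  (A *ᵥ insertAt w i 0#) r ≈ ∑ R (λ c → A r (punchIn i c) * w c)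
  *ᵥ-insertAt-0 A i w r = begin
    (A *ᵥ insertAt w i 0#) r
      ≈⟨ ∑-remove i (λ c → A r c * insertAt w i 0# c) ⟩
    A r i * insertAt w i 0# i + ∑ R (λ c → A r (punchIn i c) * insertAt w i 0# (punchIn i c))
      ≈⟨ +-cong (*-congˡ (reflexive (insertAt-lookup w i 0#)))
                (∑-cong (λ c → *-congˡ (reflexive (insertAt-punchIn w i 0# c)))) ⟩
    A r i * 0# + ∑ R (λ c → A r (punchIn i c) * w c)
      ≈⟨ trans (+-congʳ (zeroʳ _)) (+-identityˡ _) ⟩
    ∑ R (λ c → A r (punchIn i c) * w c) ∎

  extend-kernel : ∀ {A : Matrix R (suc n)} {i w v} → IsSymmetric A → InKernel R (deleteRC R A i) w →
                  InKernel R A v → ¬ v i ≈ 0# → InKernel R A (insertAt w i 0#)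
  extend-kernel {n = n} {A = A} {i} {w} {v} A-sym w∈ker v∈ker vi≉0 =
    ∀-punchIn i (*-zero-cancelˡ vi≉0 vi*Azi≈0) Az-punchIn≈0
    where
    ŵ : Vector R (suc n)
    ŵ = insertAt w i 0#
    Az-punchIn≈0 : ∀ r → (A *ᵥ ŵ) (punchIn i r) ≈ 0#
    Az-punchIn≈0 r = trans (*ᵥ-insertAt-0 A i w (punchIn i r)) (w∈ker r)
    vi*Azi≈0 : v i * (A *ᵥ ŵ) i ≈ 0#
    vi*Azi≈0 = begin
      v i * (A *ᵥ ŵ) i
        ≈⟨ +-identityʳ _ ⟨
      v i * (A *ᵥ ŵ) i + 0#
        ≈⟨ +-congˡ (∑-zero (λ r → trans (*-congˡ (Az-punchIn≈0 r)) (zeroʳ _))) ⟨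
      v i * (A *ᵥ ŵ) i + ∑ R (λ r → v (punchIn i r) * (A *ᵥ ŵ) (punchIn i r))
        ≈⟨ ∑-remove i (λ r → v r * (A *ᵥ ŵ) r) ⟨
      ⟨ v , A *ᵥ ŵ ⟩
        ≈⟨ kernel-⊥-image A-sym v v∈ker ŵ ⟩
      0# ∎

  _+δ_ : Matrix R n → Fin n → Matrix R n
  (M +δ j) r c = M r c + δ j r * δ j c

  +δ-offdiag : ∀ M (j : Fin n) {r c} → ¬ r ≡ c → (M +δ j) r c ≈ M r c
  +δ-offdiag M j {r} {c} r≢c with j ≟ r
  ... | yes ≡.refl = trans (+-congˡ (trans (*-congˡ (δ-offdiag r≢c)) (zeroʳ _))) (+-identityʳ _)
  ... | no _       = trans (+-congˡ (zeroˡ _)) (+-identityʳ _)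

  +δ-symmetric : ∀ {M : Matrix R n} {j} → IsSymmetric M → IsSymmetric (M +δ j)
  +δ-symmetric {j = j} M-sym r c = +-cong (M-sym r c) (*-comm (δ j r) (δ j c))

  deleteRC-+δ : ∀ (A : Matrix R (suc n)) i j r c →
                (deleteRC R A i +δ j) r c ≈ deleteRC R (A +δ punchIn i j) i r c
  deleteRC-+δ A i j r c = +-congˡ (sym (*-cong (δ-punchIn i j r) (δ-punchIn i j c)))

  InS-+δ : ∀ {G : Graph n} {M : Matrix R n} {j} → InS R G M → InS R G (M +δ j)
  InS-+δ {M = M} {j = j} (M-sym , M-pattern) = +δ-symmetric {j = j} M-sym , λ r c r≢c →
    let (nonzero⇒edge , edge⇒nonzero) = M-pattern r c r≢c
    in (λ B≉0 → nonzero⇒edge (λ M≈0 → B≉0 (trans (+δ-offdiag M j r≢c) M≈0))) ,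
       (λ edge B≈0 → edge⇒nonzero edge (trans (sym (+δ-offdiag M j r≢c)) B≈0))

  *ᵥ-+δ : ∀ M (j : Fin n) z r → ((M +δ j) *ᵥ z) r ≈ (M *ᵥ z) r + δ j r * z j
  *ᵥ-+δ M j z r = begin
    ∑ R (λ c → (M r c + δ j r * δ j c) * z c)
      ≈⟨ ∑-cong (λ c → trans (distribʳ (z c) (M r c) _) (+-congˡ (*-assoc (δ j r) (δ j c) (z c)))) ⟩
    ∑ R (λ c → M r c * z c + δ j r * (δ j c * z c))
      ≈⟨ ∑-distrib-+ (λ c → M r c * z c) _ ⟩
    (M *ᵥ z) r + ∑ R (λ c → δ j r * (δ j c * z c))
      ≈⟨ +-congˡ (trans (sym (*-distribˡ-∑ (δ j r) (λ c → δ j c * z c))) (*-congˡ (∑-δ j z))) ⟩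
    (M *ᵥ z) r + δ j r * z j ∎

  *ᵥ-+δ-vanishing : ∀ M {j : Fin n} {z} → z j ≈ 0# → ∀ r → ((M +δ j) *ᵥ z) r ≈ (M *ᵥ z) r
  *ᵥ-+δ-vanishing M {j} {z} zj≈0 r = begin
    ((M +δ j) *ᵥ z) r        ≈⟨ *ᵥ-+δ M j z r ⟩
    (M *ᵥ z) r + δ j r * z j ≈⟨ +-congˡ (trans (*-congˡ zj≈0) (zeroʳ _)) ⟩
    (M *ᵥ z) r + 0#          ≈⟨ +-identityʳ _ ⟩
    (M *ᵥ z) r               ∎

  ⟨⟩-+δ : ∀ M (j : Fin n) v z → ⟨ v , (M +δ j) *ᵥ z ⟩ ≈ ⟨ v , M *ᵥ z ⟩ + v j * z j
  ⟨⟩-+δ M j v z = begin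
    ∑ R (λ r → v r * ((M +δ j) *ᵥ z) r)
      ≈⟨ ∑-cong (λ r → trans (*-congˡ (*ᵥ-+δ M j z r)) (distribˡ (v r) _ _)) ⟩
    ∑ R (λ r → v r * (M *ᵥ z) r + v r * (δ j r * z j))
      ≈⟨ ∑-distrib-+ (λ r → v r * (M *ᵥ z) r) _ ⟩
    ⟨ v , M *ᵥ z ⟩ + ∑ R (λ r → v r * (δ j r * z j))
      ≈⟨ +-congˡ (trans (∑-cong (λ r → x∙yz≈y∙xz (v r) (δ j r) (z j)))
                        (∑-δ j (λ r → v r * z j))) ⟩
    ⟨ v , M *ᵥ z ⟩ + v j * z j ∎

  kernel-+δ⇒kernel : ∀ {M : Matrix R n} {v j z} → IsSymmetric M → InKernel R M v → ¬ v j ≈ 0# →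
                     InKernel R (M +δ j) z → z j ≈ 0# × InKernel R M z
  kernel-+δ⇒kernel {M = M} {v} {j} {z} M-sym v∈ker vj≉0 z∈ker = zj≈0 ,
    λ r → trans (sym (*ᵥ-+δ-vanishing M zj≈0 r)) (z∈ker r)
    where
    zj≈0 : z j ≈ 0#
    zj≈0 = *-zero-cancelˡ vj≉0 (begin
      v j * z j                      ≈⟨ +-identityˡ _ ⟨
      0# + v j * z j                 ≈⟨ +-congʳ (kernel-⊥-image M-sym v v∈ker z) ⟨
      ⟨ v , M *ᵥ z ⟩ + v j * z j     ≈⟨ ⟨⟩-+δ M j v z ⟨
      ⟨ v , (M +δ j) *ᵥ z ⟩          ≈⟨ ∑-zero (λ r → trans (*-congˡ (z∈ker r)) (zeroʳ _)) ⟩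
      0#                             ∎)

  independent⇒nonzero : ∀ {vs : Fin p → Vector R n} → LinearlyIndependent R vs →
                        ∀ a → ¬ (∀ r → vs a r ≈ 0#)
  independent⇒nonzero {vs = vs} vs-indep a vs-a≈0 =
    0≉1 (trans (sym (vs-indep (δ a) (λ r → trans (∑-δ a (λ b → vs b r)) (vs-a≈0 r)) a)) (δ-diag a))

  ∷-independent : ∀ {z : Vector R n} {r} {vs : Fin p → Vector R n} → LinearlyIndependent R vs →
                  ¬ z r ≈ 0# → (∀ b → vs b r ≈ 0#) → LinearlyIndependent R (z ∷ vs)
  ∷-independent {z = z} {r} {vs} vs-indep zr≉0 vsr≈0 c comb≈0 =
    λ { zero → c₀≈0 ; (suc b) → vs-indep (c ∘ suc) tail≈0 b }
    where
    tail-r≈0 : ∑ R (λ b → c (suc b) * vs b r) ≈ 0#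
    tail-r≈0 = ∑-zero (λ b → trans (*-congˡ (vsr≈0 b)) (zeroʳ _))
    c₀≈0 : c zero ≈ 0#
    c₀≈0 = *-zero-cancelʳ zr≉0 (trans (sym (+-identityʳ _)) (trans (+-congˡ (sym tail-r≈0)) (comb≈0 r)))
    tail≈0 : ∀ r′ → ∑ R (λ b → c (suc b) * vs b r′) ≈ 0#
    tail≈0 r′ = trans (sym (+-identityˡ _))
                  (trans (+-congʳ (sym (trans (*-congʳ c₀≈0) (zeroˡ _)))) (comb≈0 r′))

  ∷-indepKernelFamily : ∀ {M : Matrix R n} {z r} → InKernel R M z → ¬ z r ≈ 0# →
                        (F : IndepKernelFamily R M p) → (∀ b → proj₁ F b r ≈ 0#) →
                        IndepKernelFamily R M (suc p)
  ∷-indepKernelFamily {z = z} z∈ker zr≉0 (vs , vs∈ker , vs-indep) vsr≈0 =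
    z ∷ vs , (λ { zero → z∈ker ; (suc b) → vs∈ker b }) , ∷-independent vs-indep zr≉0 vsr≈0

  -- Coefficients c of the sheared family give the coefficients of the original
  -- family: c on the other vectors and σ = ∑ c t s t on vs a.
  independent-shear : ∀ {vs : Fin (suc p) → Vector R n} → LinearlyIndependent R vs →
                      (a : Fin (suc p)) (s : Fin p → Carrier) →
                      LinearlyIndependent R (λ t r → vs (punchIn a t) r + s t * vs a r)
  independent-shear {p = p} {vs = vs} vs-indep a s c comb≈0 t = begin
    c t              ≡⟨ insertAt-punchIn c a σ t ⟨
    d (punchIn a t)  ≈⟨ vs-indep d d-comb≈0 (punchIn a t) ⟩
    0#               ∎
    where
    σ : Carrier
    σ = ∑ R (λ t → c t * s t)
    d : Fin (suc p) → Carrier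
    d = insertAt c a σ
    d-comb≈0 : ∀ r → ∑ R (λ b → d b * vs b r) ≈ 0#
    d-comb≈0 r = begin
      ∑ R (λ b → d b * vs b r)
        ≈⟨ ∑-remove a (λ b → d b * vs b r) ⟩
      d a * vs a r + ∑ R (λ t → d (punchIn a t) * vs (punchIn a t) r)
        ≈⟨ +-cong (*-congʳ (reflexive (insertAt-lookup c a σ)))
                  (∑-cong (λ t → *-congʳ (reflexive (insertAt-punchIn c a σ t)))) ⟩
      σ * vs a r + ∑ R (λ t → c t * vs (punchIn a t) r)
        ≈⟨ trans (+-comm _ _) (+-congˡ (*-distribʳ-∑ (vs a r) (λ t → c t * s t))) ⟩
      ∑ R (λ t → c t * vs (punchIn a t) r) + ∑ R (λ t → c t * s t * vs a r)
        ≈⟨ ∑-distrib-+ (λ t → c t * vs (punchIn a t) r) _ ⟨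
      ∑ R (λ t → c t * vs (punchIn a t) r + c t * s t * vs a r)
        ≈⟨ ∑-cong (λ t → trans (distribˡ (c t) _ _) (+-congˡ (sym (*-assoc (c t) (s t) (vs a r))))) ⟨
      ∑ R (λ t → c t * (vs (punchIn a t) r + s t * vs a r))
        ≈⟨ comb≈0 r ⟩
      0# ∎

  KernelSupport : Matrix R n → Fin n → Set
  KernelSupport M j = ∃ λ v → InKernel R M v × ¬ v j ≈ 0#

  eliminate-coordinate : ∀ {M : Matrix R n} {j} (vs : Fin (suc p) → Vector R n) →
                         (∀ a → InKernel R M (vs a)) → LinearlyIndependent R vs →
                         ∀ a → ¬ vs a j ≈ 0# → IndepKernelFamily R (M +δ j) p
  eliminate-coordinate {n = n} {p = p} {M = M} {j} vs vs∈ker vs-indep a vₐj≉0 =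
    us , us∈ker , independent-shear {vs = vs} vs-indep a s
    where
    vₐ : Vector R n
    vₐ = vs a
    v′ : Fin p → Vector R n
    v′ = vs ∘ punchIn a
    vₐj⁻¹ : Carrier
    vₐj⁻¹ = proj₁ (inverse (vₐ j) vₐj≉0)
    vₐj*vₐj⁻¹≈1 : vₐ j * vₐj⁻¹ ≈ 1#
    vₐj*vₐj⁻¹≈1 = proj₂ (inverse (vₐ j) vₐj≉0)
    s : Fin p → Carrier
    s t = - (v′ t j * vₐj⁻¹)
    us : Fin p → Vector R n
    us t r = v′ t r + s t * vₐ r
    us-j≈0 : ∀ t → us t j ≈ 0#
    us-j≈0 t = begin
      v′ t j + - (v′ t j * vₐj⁻¹) * vₐ j
        ≈⟨ +-congˡ (-‿distribˡ-* _ _) ⟨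
      v′ t j + - (v′ t j * vₐj⁻¹ * vₐ j)
        ≈⟨ +-congˡ (-‿cong (trans (*-assoc _ _ _) (*-congˡ (*-comm vₐj⁻¹ (vₐ j))))) ⟩
      v′ t j + - (v′ t j * (vₐ j * vₐj⁻¹))
        ≈⟨ +-congˡ (-‿cong (trans (*-congˡ vₐj*vₐj⁻¹≈1) (*-identityʳ _))) ⟩
      v′ t j + - v′ t j
        ≈⟨ -‿inverseʳ _ ⟩
      0# ∎
    us∈ker : ∀ t → InKernel R (M +δ j) (us t)
    us∈ker t r = trans (*ᵥ-+δ-vanishing M (us-j≈0 t) r)
                       (InKernel-+* {M = M} {v′ t} {vₐ} (vs∈ker (punchIn a t)) (vs∈ker a) (s t) r)

  nullity-+δ : ∀ {M : Matrix R n} {j} → IsSymmetric M → Nullity R M (suc p) →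
               KernelSupport M j → Nullity R (M +δ j) p
  nullity-+δ {p = p} {M = M} {j} M-sym ((vs , vs∈ker , vs-indep) , maximal) (v , v∈ker , vj≉0) =
    eliminate-coordinate vs vs∈ker vs-indep (proj₁ pivot) (proj₂ pivot) , no-larger
    where
    pivot : ∃ λ a → ¬ vs a j ≈ 0#
    pivot = nonzero-index (λ a → vs a j)
              (maximal ∘ ∷-indepKernelFamily {z = v} v∈ker vj≉0 (vs , vs∈ker , vs-indep))
    no-larger : ¬ IndepKernelFamily R (M +δ j) (suc p)
    no-larger (zs , zs∈ker , zs-indep) =
      maximal (∷-indepKernelFamily {z = v} v∈ker vj≉0
                 (zs , (λ b → proj₂ (restriction b)) , zs-indep) (λ b → proj₁ (restriction b)))
      where
      restriction : ∀ b → zs b j ≈ 0# × InKernel R M (zs b)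
      restriction b = kernel-+δ⇒kernel {v = v} {z = zs b} M-sym v∈ker vj≉0 (zs∈ker b)

  common-support : ∀ {k ℓ} {A : Matrix R (suc n)} {i} → IsSymmetric A →
                   Nullity R A (suc k) → Nullity R (deleteRC R A i) (suc ℓ) →
                   ∃ λ j → KernelSupport A (punchIn i j) × KernelSupport (deleteRC R A i) j
  common-support {A = A} {i} A-sym ((vs , vs∈ker , vs-indep) , maximal)
                                   ((ws , ws∈ker , ws-indep) , maximal′) =
    let (j , a , b , vw≉0) = nonzero-entry (λ j a b → vs a (punchIn i j) * ws b j) supports-meet
    in j , (vs a , vs∈ker a , λ v≈0 → vw≉0 (trans (*-congʳ v≈0) (zeroˡ _)))
         , (ws b , ws∈ker b , λ w≈0 → vw≉0 (trans (*-congˡ w≈0) (zeroʳ _)))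
    where
    supports-meet : ¬ (∀ j a b → vs a (punchIn i j) * ws b j ≈ 0#)
    supports-meet disjoint =
      let (a , decisive) = decisive-index (λ a → vs a i)
      in root-nonzero a (root-vanishes ∘ decisive)
      where
      root-vanishes : (∀ a → vs a i ≈ 0#) → ⊥
      root-vanishes vsi≈0 =
        let y = vs zero ∘ punchIn i
            y≉0 = independent⇒nonzero {vs = vs} vs-indep zero
                    ∘ ∀-punchIn {P = λ r → vs zero r ≈ 0#} i (vsi≈0 zero)
            (r , yr≉0) = nonzero-index y y≉0
        in maximal′ (∷-indepKernelFamily {M = deleteRC R A i} {z = y}
                       (restrict-kernel A i {vs zero} (vs∈ker zero) (vsi≈0 zero)) yr≉0
                       (ws , ws∈ker , ws-indep) (λ b → *-zero-cancelˡ yr≉0 (disjoint r zero b)))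
      root-nonzero : ∀ a → ¬ ¬ vs a i ≈ 0#
      root-nonzero a vai≉0 =
        let w = ws zero
            ŵ = insertAt w i 0#
            (r , wr≉0) = nonzero-index w (independent⇒nonzero {vs = ws} ws-indep zero)
            ŵr≉0 = λ ŵr≈0 → wr≉0 (trans (sym (reflexive (insertAt-punchIn w i 0# r))) ŵr≈0)
        in maximal (∷-indepKernelFamily {M = A} {z = ŵ} {r = punchIn i r}
                      (extend-kernel {A = A} {i} {w} {vs a} A-sym (ws∈ker zero) (vs∈ker a) vai≉0) ŵr≉0
                      (vs , vs∈ker , vs-indep) (λ a′ → *-zero-cancelʳ wr≉0 (disjoint r a′ zero)))

theorem3p1 : (R : RealField) (m : ℕ) (G : Graph (suc m)) (i : Fin (suc m)) (k ℓ : ℕ) →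
    Allows R G i (suc k) (suc ℓ) → Allows R G i k ℓ
theorem3p1 R m G i k ℓ (A , A∈S@(A-sym , _) , N , N′) =
  let open NullityPairs R
      (j , A-support , A[i]-support) = common-support A-sym N N′
  in A +δ punchIn i j ,
     InS-+δ {G = G} {j = punchIn i j} A∈S ,
     nullity-+δ {j = punchIn i j} A-sym N A-support ,
     Nullity-cong (deleteRC-+δ A i j)
       (nullity-+δ {M = deleteRC R A i} {j} (λ r c → A-sym _ _) N′ A[i]-support)
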